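{- Let $n=2^s p_1^{\alpha_1}\cdots p_k^{\alpha_k}$ with $k\ge1$, $s\in\{0,1\}$, positive integers $\alpha_i$, and distinct primes $p_i\equiv1\pmod 4$. Then $G_n$ is not a complete graph.
   Context: The graph $G_n$ has vertex set $\mathbb{Z}_n$, and distinct $a,b$ are adjacent iff $a-b\equiv x^2\pmod n$ for some unit $x\in\mathbb{Z}_n^{\ast}$. -}

module Defs where

open import Data.Nat using (ℕ; _*_; _^_; _≤_; _%_)
open import Data.Nat.Coprimality using (Coprime)
open import Data.Nat.Primality using (Prime)
open import Data.Fin using (Fin; toℕ)
open import Data.Integer as ℤ using (ℤ; +_)
open import Data.Integer.Divisibility using () renaming (_∣_ to _∣ℤ_)
open import Data.Product using (Σ; _×_; proj₁; proj₂)
open import Data.List using (List; map)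
open import Data.Nat.ListAction using (product)
open import Data.List.Relation.Unary.All using (All)
open import Relation.Binary.PropositionalEquality using (_≡_; _≢_)
open import Relation.Nullary using (¬_)

-- Adjacency in the unitary Cayley-type graph G_n on vertex set Z_n = Fin n:
-- distinct a, b are adjacent iff a - b ≡ x² (mod n) for some unit x of Z_n,
-- i.e. some natural x with gcd(x, n) = 1.
Adjacent : (n : ℕ) → Fin n → Fin n → Set
Adjacent n a b =
  (a ≢ b) ×
  Σ ℕ (λ x → Coprime x n ×
    ((+ n) ∣ℤ ((+ toℕ a) ℤ.- (+ toℕ b) ℤ.- (+ (x * x)))))

IsComplete : (n : ℕ) → Set
IsComplete n = (a b : Fin n) → a ≢ b → Adjacent n a b

primePowerProduct : List (Σ ℕ (λ _ → ℕ)) → ℕ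
primePowerProduct ps = product (map (λ pa → proj₁ pa ^ proj₂ pa) ps)

-- If a prime p divides n and p < n, the vertex p is not adjacent to 0: p ≡ x² (mod n) forces
-- p ∣ x, so x is not a unit.  This leaves n = p, an odd prime.  For odd n = 2m + 1 every x is
-- ± h (mod n) for some h ≤ m, so squares take at most m + 1 values mod n, whereas completeness
-- would make all n residues squares.
module Submission where

open import Defs
open import Data.Nat using (ℕ; _*_; _^_; _≤_; _%_; _<_)
open import Data.Nat.Primality using (Prime)
open import Data.Product using (Σ; _×_; _,_; proj₁; proj₂)
open import Data.List using (List; map; length)
open import Data.List.Relation.Unary.All using (All)
open import Data.List.Relation.Unary.Unique.Propositional using (Unique)
open import Relation.Binary.PropositionalEquality using (_≡_)
open import Relation.Nullary using (¬_)

open import Data.Nat as ℕ using (zero; suc; _+_; _∸_; NonZero; z≤n; s≤s)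
import Data.Nat.Properties as ℕ
open import Data.Nat.Divisibility as ℕ∣ using (>⇒∤) renaming (_∣_ to _∣ℕ_)
open import Data.Nat.DivMod using (_/_; m≡m%n+[m/n]*n; m%n<n; m≥n⇒m/n>0; m∣n⇒o%n%m≡o%m)
open import Data.Nat.Coprimality using (Coprime)
open import Data.Nat.Primality using (euclidsLemma; ¬prime[0]; ¬prime[1]; prime⇒nonZero; prime⇒nonTrivial)
open import Data.Integer as ℤ using (ℤ; +_; -_; _-_; ∣_∣)
import Data.Integer.Properties as ℤ
open import Data.Integer.Divisibility.Signed using (_∣_; divides; ∣ᵤ⇒∣; ∣⇒∣ᵤ; ∣-refl; ∣-trans;
  ∣m∣n⇒∣m-n; ∣m∣n⇒∣m+n; ∣m⇒∣-m; ∣m⇒∣m*n; ∣n⇒∣m*n)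
open import Data.Integer.Tactic.RingSolver using (solve-∀)
import Data.Nat.Tactic.RingSolver as ℕ-Solver
open import Data.Fin using (Fin; zero; suc; toℕ; fromℕ<)
open import Data.Fin.Properties using (toℕ-fromℕ<; toℕ<n; pigeonhole)
open import Data.List using ([]; _∷_)
open import Data.List.Relation.Unary.All using ([]; _∷_)
import Data.List.Relation.Unary.All as All
open import Data.Sum using (_⊎_; inj₁; inj₂; reduce)
open import Relation.Binary.PropositionalEquality using (_≢_; refl; sym; trans; cong; cong₂; subst; subst₂;
  module ≡-Reasoning)
open import Relation.Nullary using (yes; no; contradiction)

infix 4 _≡_mod_

record _≡_mod_ (a b : ℤ) (n : ℕ) : Set where
  constructor congruent
  field divides-difference : + n ∣ a - b

module _ {n : ℕ} where

  ≡-mod-sym : ∀ {a b} → a ≡ b mod n → b ≡ a mod n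
  ≡-mod-sym {a} {b} (congruent n∣a-b) = congruent (subst (+ n ∣_) (negate-difference a b) (∣m⇒∣-m n∣a-b))
    where
    negate-difference : ∀ a b → - (a - b) ≡ b - a
    negate-difference = solve-∀

  ≡-mod-trans : ∀ {a b c} → a ≡ b mod n → b ≡ c mod n → a ≡ c mod n
  ≡-mod-trans {a} {b} {c} (congruent n∣a-b) (congruent n∣b-c) =
    congruent (subst (+ n ∣_) (telescope a b c) (∣m∣n⇒∣m+n n∣a-b n∣b-c))
    where
    telescope : ∀ a b c → (a - b) ℤ.+ (b - c) ≡ a - c
    telescope = solve-∀

  ≡-mod-divisor : ∀ {m a b} → m ∣ℕ n → a ≡ b mod n → a ≡ b mod m
  ≡-mod-divisor m∣n (congruent n∣a-b) = congruent (∣-trans (∣ᵤ⇒∣ m∣n) n∣a-b)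

  ≡±-mod⇒≡-square : ∀ {a b} → a ≡ b mod n ⊎ a ≡ - b mod n → a ℤ.* a ≡ b ℤ.* b mod n
  ≡±-mod⇒≡-square {a} {b} a≡±b =
    congruent (subst (+ n ∣_) (difference-of-squares a b) (divides-product a≡±b))
    where
    difference-of-squares : ∀ a b → (a - b) ℤ.* (a - - b) ≡ a ℤ.* a - b ℤ.* b
    difference-of-squares = solve-∀
    divides-product : a ≡ b mod n ⊎ a ≡ - b mod n → + n ∣ (a - b) ℤ.* (a - - b)
    divides-product (inj₁ (congruent n∣a-b))  = ∣m⇒∣m*n (a - - b) n∣a-b
    divides-product (inj₂ (congruent n∣a+b)) = ∣n⇒∣m*n (a - b) n∣a+b

  ≡-mod-%  : ∀ x .{{_ : NonZero n}} → + x ≡ + (x % n) mod n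
  ≡-mod-% x = congruent (divides (+ (x / n)) (begin
    + x - + r                        ≡⟨ cong (λ y → + y - + r) (m≡m%n+[m/n]*n x n) ⟩
    + (r + x / n * n) - + r          ≡⟨ cong (_- + r) (ℤ.pos-+ r (x / n * n)) ⟩
    (+ r ℤ.+ + (x / n * n)) - + r    ≡⟨ cong (λ z → (+ r ℤ.+ z) - + r) (ℤ.pos-* (x / n) n) ⟩
    (+ r ℤ.+ + (x / n) ℤ.* + n) - + r ≡⟨ cancel (+ r) (+ (x / n) ℤ.* + n) ⟩
    + (x / n) ℤ.* + n                ∎))
    where
    open ≡-Reasoning
    r : ℕ
    r = x % n
    cancel : ∀ a b → (a ℤ.+ b) - a ≡ b
    cancel = solve-∀

  ≡-mod-neg-complement : ∀ {r} → r ≤ n → + r ≡ - + (n ∸ r) mod n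
  ≡-mod-neg-complement {r} r≤n = congruent (divides (+ 1) (begin
    + r - - + (n ∸ r)        ≡⟨ cong (λ z → + r ℤ.+ z) (ℤ.neg-involutive (+ (n ∸ r))) ⟩
    + r ℤ.+ + (n ∸ r)        ≡⟨ cong +_ (ℕ.m+[n∸m]≡n r≤n) ⟩
    + n                      ≡⟨ ℤ.*-identityˡ (+ n) ⟨
    + 1 ℤ.* + n              ∎))
    where open ≡-Reasoning

  ∣-resp-≡-mod : ∀ {a b} → a ≡ b mod n → + n ∣ a → + n ∣ b
  ∣-resp-≡-mod {a} {b} (congruent n∣a-b) n∣a = subst (+ n ∣_) (cancel a b) (∣m∣n⇒∣m-n n∣a n∣a-b)
    where
    cancel : ∀ a b → a - (a - b) ≡ b
    cancel = solve-∀

  ∣∸⇒≤ : ∀ {a b} → n ∣ℕ b ∸ a → b < n → b ≤ a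
  ∣∸⇒≤ {a} {b} n∣b∸a b<n with b ∸ a in eq
  ... | zero  = ℕ.m∸n≡0⇒m≤n eq
  ... | suc _ = contradiction n∣b∸a (>⇒∤ (ℕ.≤-<-trans (subst (_≤ b) eq (ℕ.m∸n≤m b a)) b<n))

  ≤∧≡-mod⇒≡ : ∀ {a b} → a ≤ b → b < n → + a ≡ + b mod n → a ≡ b
  ≤∧≡-mod⇒≡ {a} {b} a≤b b<n (congruent n∣a-b) = ℕ.≤-antisym a≤b (∣∸⇒≤ n∣b∸a b<n)
    where
    n∣b∸a : n ∣ℕ b ∸ a
    n∣b∸a = subst (n ∣ℕ_) (trans (cong ∣_∣ (ℤ.m-n≡m⊖n a b)) (ℤ.∣⊖∣-≤ a≤b)) (∣⇒∣ᵤ n∣a-b)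

  ≡-mod-<⇒≡ : ∀ {a b} → a < n → b < n → + a ≡ + b mod n → a ≡ b
  ≡-mod-<⇒≡ {a} {b} a<n b<n a≡b with ℕ.≤-total a b
  ... | inj₁ a≤b = ≤∧≡-mod⇒≡ a≤b b<n a≡b
  ... | inj₂ b≤a = sym (≤∧≡-mod⇒≡ b≤a a<n (≡-mod-sym a≡b))

module _ (m : ℕ) where

  private
    n : ℕ
    n = suc (m + m)

  ≡±-mod-≤half : ∀ x → Σ ℕ λ h → h ≤ m × (+ x ≡ + h mod n ⊎ + x ≡ - + h mod n)
  ≡±-mod-≤half x with x % n ℕ.≤? m
  ... | yes r≤m = x % n , r≤m , inj₁ (≡-mod-% x)
  ... | no  r≰m = n ∸ x % n , complement≤m , inj₂ (≡-mod-trans (≡-mod-% x) (≡-mod-neg-complement r≤n))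
    where
    r≤n : x % n ≤ n
    r≤n = ℕ.<⇒≤ (m%n<n x n)
    complement≤m : n ∸ x % n ≤ m
    complement≤m = ℕ.≤-trans (ℕ.∸-monoʳ-≤ n (ℕ.≰⇒> r≰m)) (ℕ.≤-reflexive (ℕ.m+n∸n≡m m m))

  ≡-square-≤half : ∀ x → Σ ℕ λ h → h ≤ m × + x ℤ.* + x ≡ + h ℤ.* + h mod n
  ≡-square-≤half x = let h , h≤m , x≡±h = ≡±-mod-≤half x in h , h≤m , ≡±-mod⇒≡-square x≡±h

  small-squares-miss-a-residue : 0 < m →
    ¬ ((d : Fin n) → Σ ℕ λ h → h ≤ m × + toℕ d ≡ + h ℤ.* + h mod n)
  small-squares-miss-a-residue 0<m root =
    let i , j , i<j , same-index = pigeonhole (s≤s (ℕ.m<m+n m 0<m)) index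
    in ℕ.<⇒≢ i<j (index-injective same-index)
    where
    sqrt : Fin n → ℕ
    sqrt d = proj₁ (root d)

    sqrt≤m : ∀ d → sqrt d ≤ m
    sqrt≤m d = proj₁ (proj₂ (root d))

    d≡sqrt² : ∀ d → + toℕ d ≡ + sqrt d ℤ.* + sqrt d mod n
    d≡sqrt² d = proj₂ (proj₂ (root d))

    index : Fin n → Fin (suc m)
    index d = fromℕ< (s≤s (sqrt≤m d))

    index-injective : ∀ {i j} → index i ≡ index j → toℕ i ≡ toℕ j
    index-injective {i} {j} same-index =
      ≡-mod-<⇒≡ (toℕ<n i) (toℕ<n j) (≡-mod-trans (d≡sqrt² i) sqrt²≡j)
      where
      same-sqrt : sqrt i ≡ sqrt j
      same-sqrt = begin
        sqrt i            ≡⟨ toℕ-fromℕ< (s≤s (sqrt≤m i)) ⟨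
        toℕ (index i)     ≡⟨ cong toℕ same-index ⟩
        toℕ (index j)     ≡⟨ toℕ-fromℕ< (s≤s (sqrt≤m j)) ⟩
        sqrt j            ∎
        where open ≡-Reasoning

      sqrt²≡j : + sqrt i ℤ.* + sqrt i ≡ + toℕ j mod n
      sqrt²≡j = subst (λ h → + h ℤ.* + h ≡ + toℕ j mod n) (sym same-sqrt) (≡-mod-sym (d≡sqrt² j))

prime∣square⇒∣ : ∀ {p x} → Prime p → p ∣ℕ x * x → p ∣ℕ x
prime∣square⇒∣ {x = x} p-prime p∣x² = reduce (euclidsLemma x x p-prime p∣x²)

complete⇒unit-square : ∀ {n d} → IsComplete n → d < n → d ≢ 0 →
  Σ ℕ λ x → Coprime x n × + d ≡ + x ℤ.* + x mod n
complete⇒unit-square {n} {d} complete d<n d≢0 =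
  let _ , x , x⊥n , n∣d-0-x² = complete (fromℕ< d<n) (fromℕ< 0<n) distinct
  in x , x⊥n , congruent (subst₂ (λ u v → + n ∣ u - v) d-0≡d (ℤ.pos-* x x) (∣ᵤ⇒∣ n∣d-0-x²))
  where
  0<n : 0 < n
  0<n = ℕ.≤-<-trans z≤n d<n
  distinct : fromℕ< d<n ≢ fromℕ< 0<n
  distinct eq = d≢0 (trans (sym (toℕ-fromℕ< d<n)) (trans (cong toℕ eq) (toℕ-fromℕ< 0<n)))
  d-0≡d : + toℕ (fromℕ< d<n) - + toℕ (fromℕ< 0<n) ≡ + d
  d-0≡d = trans (cong₂ (λ u v → + u - + v) (toℕ-fromℕ< d<n) (toℕ-fromℕ< 0<n)) (ℤ.+-identityʳ (+ d))

prime-divisor<⇒¬complete : ∀ {p n} → Prime p → p ∣ℕ n → p < n → ¬ IsComplete n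
prime-divisor<⇒¬complete {p} {n} p-prime p∣n p<n complete =
  let x , x⊥n , p≡x² = complete⇒unit-square complete p<n p≢0
      p∣x² = subst (p ∣ℕ_) (ℤ.abs-* (+ x) (+ x)) (∣⇒∣ᵤ (∣-resp-≡-mod (≡-mod-divisor p∣n p≡x²) ∣-refl))
  in ¬prime[1] (subst Prime (x⊥n (prime∣square⇒∣ p-prime p∣x² , p∣n)) p-prime)
  where
  p≢0 : p ≢ 0
  p≢0 refl = ¬prime[0] p-prime

odd⇒¬complete : ∀ m → 0 < m → ¬ IsComplete (suc (m + m))
odd⇒¬complete m 0<m complete = small-squares-miss-a-residue m 0<m root
  where
  root : (d : Fin (suc (m + m))) → Σ ℕ λ h → h ≤ m × + toℕ d ≡ + h ℤ.* + h mod suc (m + m)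
  root zero    = 0 , z≤n , congruent (divides (+ 0) refl)
  root (suc i) =
    let x , _ , d≡x² = complete⇒unit-square complete (s≤s (toℕ<n i)) (λ ())
        h , h≤m , x²≡h² = ≡-square-≤half m x
    in h , h≤m , ≡-mod-trans d≡x² x²≡h²

%2≡1⇒≡1+2*[/2] : ∀ p → p % 2 ≡ 1 → p ≡ suc (p / 2 + p / 2)
%2≡1⇒≡1+2*[/2] p p%2≡1 = trans (m≡m%n+[m/n]*n p 2) (cong₂ _+_ p%2≡1 (double (p / 2)))
  where
  double : ∀ q → q * 2 ≡ q + q
  double = ℕ-Solver.solve-∀

odd-prime-divisor⇒¬complete : ∀ {p n} .{{_ : NonZero n}} →
  Prime p → p % 2 ≡ 1 → p ∣ℕ n → ¬ IsComplete n
odd-prime-divisor⇒¬complete {p} p-prime p%2≡1 p∣n with ℕ.m≤n⇒m<n∨m≡n (ℕ∣.∣⇒≤ p∣n)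
... | inj₁ p<n  = prime-divisor<⇒¬complete p-prime p∣n p<n
... | inj₂ refl =
  subst (λ n → ¬ IsComplete n) (sym (%2≡1⇒≡1+2*[/2] p p%2≡1)) (odd⇒¬complete (p / 2) 0<p/2)
  where
  0<p/2 : 0 < p / 2
  0<p/2 = m≥n⇒m/n>0 (ℕ.nonTrivial⇒n>1 p {{prime⇒nonTrivial p-prime}})

primePowerProduct≢0 : ∀ {ps} → All (λ pa → Prime (proj₁ pa)) ps → NonZero (primePowerProduct ps)
primePowerProduct≢0 []                              = _
primePowerProduct≢0 {(p , α) ∷ _} (p-prime ∷ primes) =
  ℕ.m*n≢0 (p ^ α) _ {{ℕ.m^n≢0 p α {{prime⇒nonZero p-prime}}}} {{primePowerProduct≢0 primes}}

proposition3p3 : (n s : ℕ) (ps : List (Σ ℕ (λ _ → ℕ))) →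
    s ≤ 1 →
    1 ≤ length ps →
    All (λ pa → Prime (proj₁ pa) × (proj₁ pa % 4 ≡ 1) × (1 ≤ proj₂ pa)) ps →
    Unique (map proj₁ ps) →
    n ≡ 2 ^ s * primePowerProduct ps →
    ¬ IsComplete n
proposition3p3 n s []                     _ ()
proposition3p3 n s ((p , zero)  ∷ _)    _ _ ((_ , _ , ()) ∷ _)
proposition3p3 n s ((p , suc α) ∷ rest) _ _ hyps@((p-prime , p%4≡1 , _) ∷ _) _ refl =
  odd-prime-divisor⇒¬complete {{n≢0}} p-prime p%2≡1 p∣n
  where
  n≢0 : NonZero n
  n≢0 = ℕ.m*n≢0 (2 ^ s) _ {{ℕ.m^n≢0 2 s}} {{primePowerProduct≢0 (All.map proj₁ hyps)}}
  p%2≡1 : p % 2 ≡ 1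
  p%2≡1 = trans (sym (m∣n⇒o%n%m≡o%m 2 4 p (ℕ∣.divides 2 refl))) (cong (_% 2) p%4≡1)
  p∣n : p ∣ℕ n
  p∣n = ℕ∣.∣n⇒∣m*n (2 ^ s) (ℕ∣.∣m⇒∣m*n (primePowerProduct rest) (ℕ∣.m∣m*n (p ^ α)))
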